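{- Let $\Lambda$ be a language of grounding over an atomic base $\mathfrak{B}$, $den^*$ a denotation function for its alphabet and $den$ the associated denotation function for terms. If a term $T$ of $\Lambda$ is universal with respect to $den^*$, then $den(T)$ is a universal ground.
   Context: Atomic base $\mathfrak{B}$ on a first-order background language $L$: the constants of $L$ plus an atomic system $\texttt{S}$ of rules between atomic formulas, with a domain of individuals. Grounds on $\mathfrak{B}$: closed derivations of $\texttt{S}$ for atomic sentences, objects $\wedge I(g_1,g_2)$, $\vee I(g)$, $\rightarrow I\xi^\alpha(f)$, $\exists I(g)$, $\forall Ix(f)$ for complex sentences, and $\mathfrak{B}$-operations on grounds (total constructive functions given by defining equations, mapping individuals and grounds for the instantiated domain of an operational type to grounds for the instantiated co-domain) for open/hypothetical assertions. Identity across bases $\approx_{\mathfrak{B}_1,\mathfrak{B}_2}$: same type and arity, and either the same atomic derivation or built from operations defined by the same equations applied to identical arguments. A ground $g_1$ on $\mathfrak{B}_1$ over $L_1$ is universal iff for every expansion $L_2$ of $L_1$ and every atomic base $\mathfrak{B}_2$ on $L_2$ there is a ground $g_2$ on $\mathfrak{B}_2$ with $g_1\approx_{\mathfrak{B}_1,\mathfrak{B}_2}g_2$. Standing convention of the paper: if a $\mathfrak{B}$-operation on grounds $f(\underline{x},\xi^{\tau_1},\dots,\xi^{\tau_n})$ is a universal ground, then for every sequence of individuals $\underline{k}$ of length at most that of $\underline{x}$ and for grounds $g_i$ on $\mathfrak{B}$ for $\tau_i[\underline{k}/\underline{x}]$ (for some or all $i\le n$) which are universal grounds, $f(\underline{k}/\underline{x},\dots,g_i,\dots)$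 is a universal ground. A language of grounding $\Lambda$ over $\mathfrak{B}$ has an alphabet of individual constants naming closed derivations of $\texttt{S}$, typed variables $\xi^\alpha$, and operational symbols (labels with operational types, each inhabited by some $\mathfrak{B}$-operation with matching bindings); typed terms: $\delta$, $\xi^\alpha$, $\phi\,\underline{x}\,\underline{\xi}(U_1,\dots,U_n)$. A denotation $den^*$ for the alphabet maps each individual constant to its derivation, $\xi^\alpha$ to the identity operation of type $\alpha\rhd\alpha$, primitive symbols ($\wedge I,\vee I,\rightarrow I,\exists I,\forall I,\bot_\alpha$) to the corresponding primitive operations, and each non-primitive symbol to a $\mathfrak{B}$-operation of its type; the associated $den$ is given by $den(\delta)=den^*(\delta)$, $den(\xi^\alpha)=den^*(\xi^\alpha)$, $den(\phi\,\underline{x}\,\underline{\xi}(U_1,\dots,U_n))=den^*(\phi)(\underline{y},den(U_1),\dots,den(U_n))$. A term $T$ is universal with respect to $den^*$ iff for every element $x$ of the alphabet occurring in $T$, $den^*(x)$ is a universal ground. -}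

module Defs where

open import Data.List using (List; []; _∷_)
open import Data.List.Relation.Unary.All using (All)
open import Data.List.Relation.Unary.Any using (Any)
open import Data.Maybe using (Maybe; just)
open import Data.Product using (Σ)
open import Relation.Binary.PropositionalEquality using (_≡_)

record GroundSetting : Set₁ where
  field
    Formula   : Set
    OpType    : Set
    IndVar    : Set
    Derivation : Set
    -- grounds on 𝔅 (closed derivations of S, canonical grounds,
    -- and 𝔅-operations on grounds)
    Ground     : Set
    derGround  : Derivation → Ground
    hasOpType  : Ground → OpType → Set
    idOp       : Formula → Ground
    PrimLabel  : Set                           -- ∧I, ∨I, →I, ∃I, ∀I, ⊥_α (with their indices)
    primOp     : PrimLabel → Ground
    apply      : Ground → List IndVar → List Ground → Ground
    -- pairs (L₂ , 𝔅₂): expansions L₂ of L with an atomic base 𝔅₂ on L₂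
    Target     : Set
    GroundOn   : Target → Set
    SameAs     : Ground → (t : Target) → GroundOn t → Set

  Universal : Ground → Set
  Universal g = (t : Target) → Σ (GroundOn t) (λ g₂ → SameAs g t g₂)

-- The paper's standing convention: universal operations applied to
-- universal grounds yield universal grounds.
StandingConvention : GroundSetting → Set
StandingConvention G = ∀ f ys gs → Universal f → All Universal gs → Universal (apply f ys gs)
  where open GroundSetting G

record Language (G : GroundSetting) : Set₁ where
  open GroundSetting G
  field
    Const     : Set
    constDer  : Const → Derivation
    Var       : Set
    varType   : Var → Formula
    Sym       : Set
    symType   : Sym → OpType
    symInhab  : (φ : Sym) → Σ Ground (λ f → hasOpType f (symType φ))
    primOf    : Sym → Maybe PrimLabel     -- just p iff φ is a primitive symbol

module _ {G : GroundSetting} (Λ : Language G) where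
  open GroundSetting G
  open Language Λ

  data Term : Set where
    const : Const → Term
    var   : Var → Term
    app   : Sym → List IndVar → List Var → List Term → Term

  data Letter : Set where
    cL : Const → Letter
    vL : Var → Letter
    sL : Sym → Letter

  data OccursIn : Letter → Term → Set where
    occ-const : ∀ δ → OccursIn (cL δ) (const δ)
    occ-var   : ∀ ξ → OccursIn (vL ξ) (var ξ)
    occ-sym   : ∀ φ xs ξs Us → OccursIn (sL φ) (app φ xs ξs Us)
    occ-bound : ∀ φ xs ξs Us ξ → Any (_≡_ ξ) ξs → OccursIn (vL ξ) (app φ xs ξs Us)
    occ-arg   : ∀ φ xs ξs Us a → Any (OccursIn a) Us → OccursIn a (app φ xs ξs Us)

  record Denotation : Set where
    field
      dConst : Const → Ground
      dVar   : Var → Ground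
      dSym   : Sym → Ground
      dConst-ok : ∀ δ → dConst δ ≡ derGround (constDer δ)
      dVar-ok   : ∀ ξ → dVar ξ ≡ idOp (varType ξ)
      dSym-prim : ∀ φ p → primOf φ ≡ just p → dSym φ ≡ primOp p
      dSym-type : ∀ φ → hasOpType (dSym φ) (symType φ)

    den* : Letter → Ground
    den* (cL δ) = dConst δ
    den* (vL ξ) = dVar ξ
    den* (sL φ) = dSym φ

    den     : Term → Ground
    denList : List Term → List Ground
    den (const δ) = dConst δ
    den (var ξ) = dVar ξ
    den (app φ ys ξs Us) = apply (dSym φ) ys (denList Us)
    denList [] = []
    denList (U ∷ Us) = den U ∷ denList Us

  UniversalTerm : Denotation → Term → Set
  UniversalTerm D T = ∀ a → OccursIn a T → Universal (Denotation.den* D a)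

module Submission where

open import Defs
open import Data.List using (List; []; _∷_)
open import Data.List.Relation.Unary.All using (All; []; _∷_)
open import Data.List.Relation.Unary.Any using (Any; here; there)

-- Structural induction on the term: constants and variables are letters
-- themselves, and an application denotes a universal operation applied
-- to universal grounds, which the standing convention keeps universal.

module _ {G : GroundSetting} (convention : StandingConvention G)
         {Λ : Language G} (D : Denotation Λ) where
  open GroundSetting G
  open Denotation D

  AllLettersUniversal : List (Term Λ) → Set
  AllLettersUniversal Us = ∀ a → Any (OccursIn Λ a) Us → Universal (den* a)

  den-universal     : ∀ T → UniversalTerm Λ D T → Universal (den T)
  denList-universal : ∀ Us → AllLettersUniversal Us → All Universal (denList Us)

  den-universal (const δ) u = u (cL δ) (occ-const δ)
  den-universal (var ξ)   u = u (vL ξ) (occ-var ξ)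
  den-universal (app φ ys ξs Us) u =
    convention (dSym φ) ys (denList Us)
      (u (sL φ) (occ-sym φ ys ξs Us))
      (denList-universal Us (λ a p → u a (occ-arg φ ys ξs Us a p)))

  denList-universal []       u = []
  denList-universal (U ∷ Us) u =
    den-universal U (λ a p → u a (here p)) ∷
    denList-universal Us (λ a p → u a (there p))

proposition23 : (G : GroundSetting) → StandingConvention G →
                (Λ : Language G) (D : Denotation Λ) (T : Term Λ) →
                UniversalTerm Λ D T →
                GroundSetting.Universal G (Denotation.den D T)
proposition23 G convention Λ D = den-universal convention D
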